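{- Let $\mathcal{A}$ be a finite alphabet of modalities and $L$ a $2$-finite normal modal logic over $\mathcal{A}$. Let $p$ and $q$ be distinct variables. Then there exists $m<\omega$ such that: (1) $L\vdash q\to[\Diamond_{\mathcal{A}}^{m+1}p\to\Diamond_{\mathcal{A}}^{\le m}p]_q$; and (2) if moreover $L$ is Kripke complete, then there exists $h<\omega$ such that $L\vdash q\to[B_h^{[m]}]_q$, where $q$ is chosen not to occur in $B_h^{[m]}$.
   Context: Formulas over $\mathcal{A}$ are built from variables $p_0,p_1,\ldots$ with $\bot,\to$, $\Diamond\in\mathcal{A}$. A normal modal logic is a set of formulas containing classical tautologies, $\neg\Diamond\bot$ and $\Diamond(p_0\vee p_1)\to\Diamond p_0\vee\Diamond p_1$ for each $\Diamond$, closed under modus ponens, substitution and monotonicity ($\varphi\to\psi\in L$ implies $\Diamond\varphi\to\Diamond\psi\in L$). $L$ is $2$-finite if only finitely many formulas in $p_0,p_1$ are pairwise non-equivalent modulo $L$; $L$ is Kripke complete if it is the set of formulas valid in some class of Kripke frames. Abbreviations: $\Diamond_{\mathcal{A}}\varphi=\bigvee_{\Diamond\in\mathcal{A}}\Diamond\varphi$, $\Box_{\mathcal{A}}=\neg\Diamond_{\mathcal{A}}\neg$, $\Diamond_{\mathcal{A}}^0\varphi=\varphi$, $\Diamond_{\mathcal{A}}^{i+1}\varphi=\Diamond_{\mathcal{A}}^i\Diamond_{\mathcal{A}}\varphi$, $\Diamond_{\mathcal{A}}^{\le m}\varphi=\bigvee_{i\le m}\Diamond_{\mathcal{A}}^i\varphi$,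 $\Box_{\mathcal{A}}^{\le m}\varphi=\neg\Diamond_{\mathcal{A}}^{\le m}\neg\varphi$. The formulas $B_h^{[m]}$ are: $B_0^{[m]}=\bot$, $B_h^{[m]}=p_h\to\Box_{\mathcal{A}}^{\le m}(\Diamond_{\mathcal{A}}^{\le m}p_h\vee B_{h-1}^{[m]})$. The relativization $[\varphi]_\xi$ is: $[\bot]_\xi=\bot$, $[p]_\xi=p$, $[\psi_1\to\psi_2]_\xi=[\psi_1]_\xi\to[\psi_2]_\xi$, $[\Diamond\psi]_\xi=\Diamond(\xi\wedge[\psi]_\xi)$ for $\Diamond\in\mathcal{A}$ (so $\Diamond_{\mathcal{A}}$ etc. are relativized after unfolding the abbreviations). -}

module Defs where

open import Data.Nat using (ℕ; zero; suc; _<_)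
open import Data.Fin using (Fin)
open import Data.List using (List; []; _∷_; foldr; map)
open import Data.List.Relation.Unary.Any using (Any)
open import Data.Bool using (Bool; true; false; _∧_; not) renaming (_∨_ to _or_)
open import Data.Product using (Σ; ∃; _×_; _,_)
open import Data.Sum using (_⊎_)
open import Data.Empty using (⊥)
open import Relation.Binary.PropositionalEquality using (_≡_)
open import Relation.Nullary using (¬_)
import Data.List as L

data Fm (k : ℕ) : Set where
  var : ℕ → Fm k
  bot : Fm k
  _⇒_ : Fm k → Fm k → Fm k
  dia : Fin k → Fm k → Fm k

infixr 4 _⇒_

module _ {k : ℕ} where

  neg : Fm k → Fm k
  neg φ = φ ⇒ bot

  top : Fm k
  top = neg bot

  _∨ᶠ_ : Fm k → Fm k → Fm k
  φ ∨ᶠ ψ = neg φ ⇒ ψ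

  _∧ᶠ_ : Fm k → Fm k → Fm k
  φ ∧ᶠ ψ = neg (φ ⇒ neg ψ)

  _⇔_ : Fm k → Fm k → Fm k
  φ ⇔ ψ = (φ ⇒ ψ) ∧ᶠ (ψ ⇒ φ)

  bigOr : List (Fm k) → Fm k
  bigOr = foldr _∨ᶠ_ bot

  diaA : Fm k → Fm k
  diaA φ = bigOr (map (λ a → dia a φ) (L.allFin k))

  boxA : Fm k → Fm k
  boxA φ = neg (diaA (neg φ))

  diaA^ : ℕ → Fm k → Fm k
  diaA^ zero φ = φ
  diaA^ (suc i) φ = diaA^ i (diaA φ)

  diaA≤ : ℕ → Fm k → Fm k
  diaA≤ m φ = bigOr (map (λ i → diaA^ i φ) (L.upTo (suc m)))

  boxA≤ : ℕ → Fm k → Fm k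
  boxA≤ m φ = neg (diaA≤ m (neg φ))

  B : ℕ → ℕ → Fm k
  B m zero = bot
  B m (suc h) = var (suc h) ⇒ boxA≤ m (diaA≤ m (var (suc h)) ∨ᶠ B m h)

  rel : Fm k → Fm k → Fm k
  rel ξ (var n) = var n
  rel ξ bot = bot
  rel ξ (φ ⇒ ψ) = rel ξ φ ⇒ rel ξ ψ
  rel ξ (dia a φ) = dia a (ξ ∧ᶠ rel ξ φ)

  subst : (ℕ → Fm k) → Fm k → Fm k
  subst σ (var n) = σ n
  subst σ bot = bot
  subst σ (φ ⇒ ψ) = subst σ φ ⇒ subst σ ψ
  subst σ (dia a φ) = dia a (subst σ φ)

  Occurs : ℕ → Fm k → Set
  Occurs n (var m) = n ≡ m
  Occurs n bot = ⊥
  Occurs n (φ ⇒ ψ) = Occurs n φ ⊎ Occurs n ψ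
  Occurs n (dia a φ) = Occurs n φ

  -- classical tautologies: true under every Boolean assignment to the
  -- propositional atoms (variables and formulas ◇ψ)
  evalB : (Fm k → Bool) → Fm k → Bool
  evalB v (var n) = v (var n)
  evalB v bot = false
  evalB v (φ ⇒ ψ) = not (evalB v φ) or evalB v ψ
  evalB v (dia a φ) = v (dia a φ)

  Tautology : Fm k → Set
  Tautology φ = (v : Fm k → Bool) → evalB v φ ≡ true

  p0 p1 : Fm k
  p0 = var 0
  p1 = var 1

  record IsNormal (L : Fm k → Set) : Set where
    field
      taut  : ∀ φ → Tautology φ → L φ
      dual  : ∀ a → L (neg (dia a bot))
      distr : ∀ a → L (dia a (p0 ∨ᶠ p1) ⇒ (dia a p0 ∨ᶠ dia a p1))
      mp    : ∀ φ ψ → L (φ ⇒ ψ) → L φ → L ψ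
      sub   : ∀ (σ : ℕ → Fm k) φ → L φ → L (subst σ φ)
      mono  : ∀ a φ ψ → L (φ ⇒ ψ) → L (dia a φ ⇒ dia a ψ)

  TwoFinite : (Fm k → Set) → Set
  TwoFinite L = Σ (List (Fm k)) λ fs →
    ∀ φ → (∀ n → Occurs n φ → n < 2) → Any (λ ψ → L (φ ⇔ ψ)) fs

  record Frame : Set₁ where
    field
      W : Set
      R : Fin k → W → W → Set

  open Frame

  -- forcing; ◇ is read via double negation so that forcing is
  -- ¬¬-stable and matches the classical semantics
  Forces : (F : Frame) → (ℕ → W F → Bool) → W F → Fm k → Set
  Forces F V w (var n) = V n w ≡ true
  Forces F V w bot = ⊥
  Forces F V w (φ ⇒ ψ) = Forces F V w φ → Forces F V w ψ
  Forces F V w (dia a φ) = ¬ ¬ (Σ (W F) λ u → R F a w u × Forces F V u φ)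

  ValidIn : Frame → Fm k → Set
  ValidIn F φ = ∀ (V : ℕ → W F → Bool) (w : W F) → Forces F V w φ

  KripkeComplete : (Fm k → Set) → Set₁
  KripkeComplete L = Σ (Frame → Set) λ C →
    ∀ φ → (L φ → ∀ F → C F → ValidIn F φ) × ((∀ F → C F → ValidIn F φ) → L φ)

-- The formulas [◇^{≤n} p₀]_{p₁} contain only p₀ and p₁, so by
-- 2-finiteness two of them, for m < n, are L-equivalent. Since
-- [◇^{m+1} p₀]_{p₁} is a disjunct of the n-th one, it implies the m-th one;
-- renaming p₀, p₁ to p, q gives (1).
--
-- In a model of L let D be the set of r-worlds. By (1), whenever a
-- formula-definable set is reachable along D-paths at all, it is reachable
-- within m steps; so "reachable within m steps" is transitive on definable
-- sets. The rank of a D-world is the largest i ≤ h such that some pₗ with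
-- i ≤ l ≤ h is reachable within m steps; ranks cannot grow along such paths.
-- Let π express "the rank is odd". An alternation π, ¬π, π, … of length n
-- along m-step paths forces rank ≥ n, while a world refuting [B_h^{[m]}]_r
-- yields, for each i ≤ h, a world of rank exactly i carrying an alternation
-- of length i. Taking for h the number of L-classes of formulas in p₀, p₁,
-- the alternation formulas of two lengths i < j ≤ h are L-equivalent, so
-- that world would have rank ≥ j > i.
--
-- Kripke semantics is read through double negation (as in Forces), so the
-- arguments run in the double-negation monad on ¬¬-stable predicates.

module Submission where

open import Defs renaming (_⇔_ to _⇔ᶠ_)
open import Agda.Primitive using (lzero)
open import Data.Bool using (Bool; true; false)
open import Data.Bool.Properties using () renaming (_≟_ to _≟ᵇ_)
open import Data.Empty using (⊥; ⊥-elim)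
open import Data.Unit using (⊤)
open import Data.Fin using (Fin; toℕ)
open import Data.Fin.Properties using (pigeonhole; toℕ<n)
open import Data.List using (List; []; _∷_; map; length; lookup; upTo; allFin; filter)
open import Data.List.Properties using (map-∘; map-cong)
open import Data.List.Relation.Unary.Any using (Any; here; there; index)
open import Data.List.Relation.Unary.Any.Properties using (lookup-index; map⁺; map⁻)
open import Data.List.Membership.Propositional using (_∈_; find; lose)
open import Data.List.Membership.Propositional.Properties
  using (∈-map⁺; ∈-upTo⁺; ∈-upTo⁻; ∈-allFin; ∈-filter⁺; ∈-filter⁻)
open import Data.Nat using (ℕ; zero; suc; _+_; _<_; _≤_; z≤n; s≤s; _≤?_)
open import Data.Nat.Properties
  using (≤-pred; ≤-refl; ≤-trans; <⇒≤; <-irrefl; <-cmp; n≤1+n; n<1+n; m≤n⇒m<n∨m≡n)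
open import Data.Product using (Σ; ∃; _×_; _,_; proj₁; proj₂)
open import Data.Product.Function.NonDependent.Propositional using (_×-⇔_)
open import Data.Sum.Function.Propositional using (_⊎-⇔_)
open import Data.Sum using (_⊎_; inj₁; inj₂; [_,_]′)
import Data.Sum
open import Effect.Monad using (RawMonad)
open import Function using (_∘_; id)
open import Function.Bundles using (_⇔_; mk⇔; Equivalence)
open import Function.Construct.Composition using (_⇔-∘_)
open import Function.Construct.Identity using (⇔-id)
open import Function.Construct.Symmetry using (⇔-sym)
open import Function.Related.TypeIsomorphisms using (→-cong-⇔; ¬-cong-⇔)
open import Relation.Unary using (_⊆_; _∩_; ∁; U; Decidable)
open import Relation.Binary using (tri<; tri≈; tri>)
open import Relation.Binary.PropositionalEquality
  using (_≡_; _≢_; refl; sym; trans; cong; cong₂) renaming (subst to substEq)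
open import Relation.Nullary using (¬_; Dec; yes; no)
open import Relation.Nullary.Decidable using (decidable-stable; ¬?; ¬¬-excluded-middle)
open import Relation.Nullary.Negation using (¬¬-Monad; ¬¬-map; negated-stable; Stable)

-- Syntax

module _ {k : ℕ} where

  subst-bigOr : (σ : ℕ → Fm k) (φs : List (Fm k)) → subst σ (bigOr φs) ≡ bigOr (map (subst σ) φs)
  subst-bigOr σ []       = refl
  subst-bigOr σ (φ ∷ φs) = cong (neg (subst σ φ) ⇒_) (subst-bigOr σ φs)

  subst-diaA : (σ : ℕ → Fm k) (φ : Fm k) → subst σ (diaA φ) ≡ diaA (subst σ φ)
  subst-diaA σ φ = trans (subst-bigOr σ (map (λ a → dia a φ) (allFin k)))
                         (cong bigOr (sym (map-∘ {g = subst σ} (allFin k))))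

  subst-diaA^ : (σ : ℕ → Fm k) (i : ℕ) (φ : Fm k) → subst σ (diaA^ i φ) ≡ diaA^ i (subst σ φ)
  subst-diaA^ σ zero    φ = refl
  subst-diaA^ σ (suc i) φ = trans (subst-diaA^ σ i (diaA φ)) (cong (diaA^ i) (subst-diaA σ φ))

  subst-diaA≤ : (σ : ℕ → Fm k) (m : ℕ) (φ : Fm k) → subst σ (diaA≤ m φ) ≡ diaA≤ m (subst σ φ)
  subst-diaA≤ σ m φ = trans (subst-bigOr σ (map (λ i → diaA^ i φ) (upTo (suc m))))
    (cong bigOr (trans (sym (map-∘ {g = subst σ} (upTo (suc m))))
                       (map-cong (λ i → subst-diaA^ σ i φ) (upTo (suc m)))))

  rename-rel : (f : ℕ → ℕ) (ξ φ : Fm k) →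
               subst (var ∘ f) (rel ξ φ) ≡ rel (subst (var ∘ f) ξ) (subst (var ∘ f) φ)
  rename-rel f ξ (var n)   = refl
  rename-rel f ξ bot       = refl
  rename-rel f ξ (φ ⇒ ψ)   = cong₂ _⇒_ (rename-rel f ξ φ) (rename-rel f ξ ψ)
  rename-rel f ξ (dia a φ) = cong (λ χ → dia a (subst (var ∘ f) ξ ∧ᶠ χ)) (rename-rel f ξ φ)

  rel-bigOr : (ξ : Fm k) (φs : List (Fm k)) → rel ξ (bigOr φs) ≡ bigOr (map (rel ξ) φs)
  rel-bigOr ξ []       = refl
  rel-bigOr ξ (φ ∷ φs) = cong (neg (rel ξ φ) ⇒_) (rel-bigOr ξ φs)

  record InP₀P₁ (φ : Fm k) : Set where
    constructor inP₀P₁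
    field vars<2 : ∀ n → Occurs n φ → n < 2
  open InP₀P₁ public

  p₀-inP₀P₁ : InP₀P₁ p0
  p₀-inP₀P₁ = inP₀P₁ λ { _ refl → s≤s z≤n }

  p₁-inP₀P₁ : InP₀P₁ p1
  p₁-inP₀P₁ = inP₀P₁ λ { _ refl → s≤s (s≤s z≤n) }

  bot-inP₀P₁ : InP₀P₁ bot
  bot-inP₀P₁ = inP₀P₁ λ _ ()

  ⇒-inP₀P₁ : ∀ {φ ψ} → InP₀P₁ φ → InP₀P₁ ψ → InP₀P₁ (φ ⇒ ψ)
  ⇒-inP₀P₁ φ∈ ψ∈ = inP₀P₁ λ { n (inj₁ o) → vars<2 φ∈ n o ; n (inj₂ o) → vars<2 ψ∈ n o }

  dia-inP₀P₁ : ∀ {a φ} → InP₀P₁ φ → InP₀P₁ (dia a φ)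
  dia-inP₀P₁ φ∈ = inP₀P₁ (vars<2 φ∈)

  neg-inP₀P₁ : ∀ {φ} → InP₀P₁ φ → InP₀P₁ (neg φ)
  neg-inP₀P₁ φ∈ = ⇒-inP₀P₁ φ∈ bot-inP₀P₁

  ∧-inP₀P₁ : ∀ {φ ψ} → InP₀P₁ φ → InP₀P₁ ψ → InP₀P₁ (φ ∧ᶠ ψ)
  ∧-inP₀P₁ φ∈ ψ∈ = neg-inP₀P₁ (⇒-inP₀P₁ φ∈ (neg-inP₀P₁ ψ∈))

  ∨-inP₀P₁ : ∀ {φ ψ} → InP₀P₁ φ → InP₀P₁ ψ → InP₀P₁ (φ ∨ᶠ ψ)
  ∨-inP₀P₁ φ∈ ψ∈ = ⇒-inP₀P₁ (neg-inP₀P₁ φ∈) ψ∈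

  bigOr-map-inP₀P₁ : {A : Set} (f : A → Fm k) (xs : List A) → (∀ x → InP₀P₁ (f x)) →
                     InP₀P₁ (bigOr (map f xs))
  bigOr-map-inP₀P₁ f []       f∈ = bot-inP₀P₁
  bigOr-map-inP₀P₁ f (x ∷ xs) f∈ = ∨-inP₀P₁ (f∈ x) (bigOr-map-inP₀P₁ f xs f∈)

  diaA-inP₀P₁ : ∀ {φ} → InP₀P₁ φ → InP₀P₁ (diaA φ)
  diaA-inP₀P₁ φ∈ = bigOr-map-inP₀P₁ _ (allFin k) (λ _ → dia-inP₀P₁ φ∈)

  diaA^-inP₀P₁ : ∀ i {φ} → InP₀P₁ φ → InP₀P₁ (diaA^ i φ)
  diaA^-inP₀P₁ zero    φ∈ = φ∈
  diaA^-inP₀P₁ (suc i) φ∈ = diaA^-inP₀P₁ i (diaA-inP₀P₁ φ∈)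

  diaA≤-inP₀P₁ : ∀ m {φ} → InP₀P₁ φ → InP₀P₁ (diaA≤ m φ)
  diaA≤-inP₀P₁ m φ∈ = bigOr-map-inP₀P₁ _ (upTo (suc m)) (λ i → diaA^-inP₀P₁ i φ∈)

  occurs-rel : (n : ℕ) (ξ φ : Fm k) → Occurs n (rel ξ φ) → Occurs n ξ ⊎ Occurs n φ
  occurs-rel n ξ (var m)   o        = inj₂ o
  occurs-rel n ξ (φ ⇒ ψ)   (inj₁ o) = Data.Sum.map₂ inj₁ (occurs-rel n ξ φ o)
  occurs-rel n ξ (φ ⇒ ψ)   (inj₂ o) = Data.Sum.map₂ inj₂ (occurs-rel n ξ ψ o)
  occurs-rel n ξ (dia a φ) (inj₁ (inj₁ o))        = inj₁ o
  occurs-rel n ξ (dia a φ) (inj₁ (inj₂ (inj₁ o))) = occurs-rel n ξ φ o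

  rel-inP₀P₁ : ∀ {ξ φ} → InP₀P₁ ξ → InP₀P₁ φ → InP₀P₁ (rel ξ φ)
  rel-inP₀P₁ {ξ} {φ} ξ∈ φ∈ =
    inP₀P₁ λ n o → [ vars<2 ξ∈ n , vars<2 φ∈ n ]′ (occurs-rel n ξ φ o)

any-pigeonhole : {A : Set} (xs : List A) (P : ℕ → A → Set) → (∀ n → Any (P n) xs) →
  Σ ℕ λ i → Σ ℕ λ j → i < j × j ≤ length xs × ∃ λ x → P i x × P j x
any-pigeonhole xs P any
  with i , j , i<j , same ← pigeonhole (n<1+n (length xs)) (index ∘ any ∘ toℕ)
  = toℕ i , toℕ j , i<j , ≤-pred (toℕ<n j)
  , _ , lookup-index (any (toℕ i)) , substEq (P (toℕ j) ∘ lookup xs) (sym same) (lookup-index (any (toℕ j)))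

module _ {k : ℕ} {L : Fm k → Set} where

  two-finite-collision : ((fs , _) : TwoFinite L) (ψ : ℕ → Fm k) → (∀ n → InP₀P₁ (ψ n)) →
    Σ ℕ λ i → Σ ℕ λ j → i < j × j ≤ length fs × ∃ λ c → L (ψ i ⇔ᶠ c) × L (ψ j ⇔ᶠ c)
  two-finite-collision (fs , classes) ψ ψ∈ =
    any-pigeonhole fs (λ n c → L (ψ n ⇔ᶠ c)) (λ n → classes (ψ n) (vars<2 (ψ∈ n)))

module _ {k : ℕ} where

  evalB-bigOr : (v : Fm k → Bool) {φ : Fm k} {φs : List (Fm k)} →
                φ ∈ φs → evalB v φ ≡ true → evalB v (bigOr φs) ≡ true
  evalB-bigOr v {φs = ψ ∷ _} (here refl) φ-true rewrite φ-true = refl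
  evalB-bigOr v {φs = ψ ∷ _} (there φ∈) φ-true with evalB v ψ
  ... | true  = refl
  ... | false = evalB-bigOr v φ∈ φ-true

  evalB-rel-diaA≤ : (v : Fm k → Bool) (ξ φ : Fm k) {i m : ℕ} → i ≤ m →
    evalB v (rel ξ (diaA^ i φ)) ≡ true → evalB v (rel ξ (diaA≤ m φ)) ≡ true
  evalB-rel-diaA≤ v ξ φ {m = m} i≤m true-i =
    substEq (λ χ → evalB v χ ≡ true) (sym (rel-bigOr ξ (map (λ i → diaA^ i φ) (upTo (suc m)))))
      (evalB-bigOr v (∈-map⁺ (rel ξ) (∈-map⁺ (λ i → diaA^ i φ) (∈-upTo⁺ (s≤s i≤m)))) true-i)

module NormalLogic {k : ℕ} {L : Fm k → Set} (N : IsNormal L) where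
  open IsNormal N

  entailment : {φ ψ : Fm k} → (∀ v → evalB v φ ≡ true → evalB v ψ ≡ true) → L (φ ⇒ ψ)
  entailment {φ} {ψ} φ⊨ψ = taut _ λ v → lemma v
    where
      lemma : ∀ v → evalB v (φ ⇒ ψ) ≡ true
      lemma v with evalB v φ in φ-value
      ... | false = refl
      ... | true  = φ⊨ψ v φ-value

  weaken : {φ ψ : Fm k} → L φ → L (ψ ⇒ φ)
  weaken {φ} {ψ} ⊢φ = mp _ _ (taut _ schema) ⊢φ
    where
      schema : Tautology (φ ⇒ ψ ⇒ φ)
      schema v with evalB v φ | evalB v ψ
      ... | true  | true  = refl
      ... | true  | false = refl
      ... | false | _     = refl

  ⇒-trans : {φ ψ χ : Fm k} → L (φ ⇒ ψ) → L (ψ ⇒ χ) → L (φ ⇒ χ)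
  ⇒-trans {φ} {ψ} {χ} φψ ψχ = mp _ _ (mp _ _ (taut _ schema) φψ) ψχ
    where
      schema : Tautology ((φ ⇒ ψ) ⇒ (ψ ⇒ χ) ⇒ φ ⇒ χ)
      schema v with evalB v φ | evalB v ψ | evalB v χ
      ... | true  | true  | true  = refl
      ... | true  | true  | false = refl
      ... | true  | false | _     = refl
      ... | false | true  | true  = refl
      ... | false | true  | false = refl
      ... | false | false | true  = refl
      ... | false | false | false = refl

  ⇔-common : {φ ψ χ : Fm k} → L (φ ⇔ᶠ χ) → L (ψ ⇔ᶠ χ) → L (ψ ⇒ φ)
  ⇔-common {φ} {ψ} {χ} φχ ψχ = mp _ _ (mp _ _ (taut _ schema) φχ) ψχ
    where
      schema : Tautology ((φ ⇔ᶠ χ) ⇒ (ψ ⇔ᶠ χ) ⇒ ψ ⇒ φ)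
      schema v with evalB v φ | evalB v ψ | evalB v χ
      ... | true  | true  | true  = refl
      ... | true  | true  | false = refl
      ... | true  | false | true  = refl
      ... | true  | false | false = refl
      ... | false | false | true  = refl
      ... | false | false | false = refl
      ... | false | true  | true  = refl
      ... | false | true  | false = refl

module _ {k : ℕ} where

  BoundedDepth : ℕ → ℕ → ℕ → Fm k
  BoundedDepth m p q = var q ⇒ rel (var q) (diaA^ (suc m) (var p) ⇒ diaA≤ m (var p))

  rename-BoundedDepth : (f : ℕ → ℕ) (m p q : ℕ) →
                        subst (var ∘ f) (BoundedDepth m p q) ≡ BoundedDepth m (f p) (f q)
  rename-BoundedDepth f m p q = cong (var (f q) ⇒_) (trans
    (rename-rel f (var q) (diaA^ (suc m) (var p) ⇒ diaA≤ m (var p)))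
    (cong (rel (var (f q))) (cong₂ _⇒_ (subst-diaA^ (var ∘ f) (suc m) (var p))
                                       (subst-diaA≤ (var ∘ f) m (var p)))))

  bounded-depth : {L : Fm k → Set} → IsNormal L → TwoFinite L → Σ ℕ λ m → L (BoundedDepth m 0 1)
  bounded-depth {L} N two
    with m , n , m<n , _ , _ , ψm≡c , ψn≡c ← two-finite-collision {L = L} two (λ n → rel p1 (diaA≤ n p0))
                                                (λ n → rel-inP₀P₁ p₁-inP₀P₁ (diaA≤-inP₀P₁ n p₀-inP₀P₁))
    = m , weaken (⇒-trans (entailment (λ v → evalB-rel-diaA≤ v p1 p0 m<n)) (⇔-common ψm≡c ψn≡c))
    where open NormalLogic N

-- Relativised Kripke semantics

open Equivalence using (to; from)
open RawMonad (¬¬-Monad {lzero}) using (_>>=_; pure)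

¬¬-cong : {A B : Set} → A ⇔ B → (¬ ¬ A) ⇔ (¬ ¬ B)
¬¬-cong = ¬-cong-⇔ ∘ ¬-cong-⇔

module Semantics {k : ℕ} (W : Set) (R : Fin k → W → W → Set) where

  -- Valuations are Set-valued so that a formula can be substituted for a
  -- variable (Sat-subst).
  Sat : (D : W → Set) (V : ℕ → W → Set) → Fm k → W → Set
  Sat D V (var n)   w = V n w
  Sat D V bot       w = ⊥
  Sat D V (φ ⇒ ψ)   w = Sat D V φ w → Sat D V ψ w
  Sat D V (dia a φ) w = ¬ ¬ (Σ W λ u → R a w u × D u × Sat D V φ u)

  Step : (D P : W → Set) → W → Set
  Step D P w = ¬ ¬ (Σ W λ u → Σ (Fin k) (λ a → R a w u) × D u × P u)

  Steps : (D : W → Set) → ℕ → (P : W → Set) → W → Set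
  Steps D zero    P = P
  Steps D (suc n) P = Steps D n (Step D P)

  Reach : (D : W → Set) → ℕ → (P : W → Set) → W → Set
  Reach D m P w = ¬ ¬ (Σ ℕ λ i → i ≤ m × Steps D i P w)

  module _ {D : W → Set} where

    Step-map : {P Q : W → Set} → P ⊆ Q → Step D P ⊆ Step D Q
    Step-map P⊆Q = ¬¬-map λ (u , a , d , p) → u , a , d , P⊆Q p

    Steps-map : {P Q : W → Set} → P ⊆ Q → ∀ n → Steps D n P ⊆ Steps D n Q
    Steps-map P⊆Q zero    = P⊆Q
    Steps-map P⊆Q (suc n) = Steps-map (Step-map P⊆Q) n

    Steps-cong : {P Q : W → Set} → (∀ {u} → P u ⇔ Q u) → ∀ n {w} → Steps D n P w ⇔ Steps D n Q w
    Steps-cong P⇔Q n = mk⇔ (Steps-map (to P⇔Q) n) (Steps-map (from P⇔Q) n)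

    Step-¬¬ : {P : W → Set} → Step D (λ u → ¬ ¬ P u) ⊆ Step D P
    Step-¬¬ s ¬step = s λ (u , a , d , ¬¬p) → ¬¬p λ p → ¬step (u , a , d , p)

    Steps-¬¬ : {P : W → Set} → ∀ n {w} → Steps D n (λ u → ¬ ¬ P u) w → ¬ ¬ Steps D n P w
    Steps-¬¬ zero    s = s
    Steps-¬¬ (suc n) s = pure (Steps-map Step-¬¬ n s)

    Step-∃ : {A : Set} {Q : A → W → Set} {w : W} →
             Step D (λ u → Σ A λ x → Q x u) w → ¬ ¬ Σ A λ x → Step D (Q x) w
    Step-∃ s = do
      (u , a , d , x , q) ← s
      pure (x , pure (u , a , d , q))

    Steps-∃ : {A : Set} {Q : A → W → Set} → ∀ n {w} →
              Steps D n (λ u → Σ A λ x → Q x u) w → ¬ ¬ Σ A λ x → Steps D n (Q x) w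
    Steps-∃ zero    s = pure s
    Steps-∃ (suc n) s = do
      s′ ← Steps-¬¬ n (Steps-map Step-∃ n s)
      Steps-∃ n s′

    Step-⊎ : {P Q : W → Set} {w : W} →
             Step D (λ u → P u ⊎ Q u) w → ¬ ¬ (Step D P w ⊎ Step D Q w)
    Step-⊎ s = do
      (u , a , d , p⊎q) ← s
      pure (Data.Sum.map (λ p → pure (u , a , d , p)) (λ q → pure (u , a , d , q)) p⊎q)

    Steps-⊎ : {P Q : W → Set} → ∀ n {w} →
              Steps D n (λ u → P u ⊎ Q u) w → ¬ ¬ (Steps D n P w ⊎ Steps D n Q w)
    Steps-⊎ zero    s = pure s
    Steps-⊎ (suc n) s = do
      s′ ← Steps-¬¬ n (Steps-map Step-⊎ n s)
      Steps-⊎ n s′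

    Steps-∩ : {P : W → Set} → ∀ n {w} → D w → Steps D n P w → Steps D n (D ∩ P) w
    Steps-∩ zero    d p = d , p
    Steps-∩ (suc n) _ s = Steps-map (¬¬-map λ (u , a , d , p) → u , a , d , d , p) n s

    Steps-+ : {P : W → Set} → ∀ i j {w} → Steps D i (Steps D j P) w → Steps D (j + i) P w
    Steps-+ i zero    s = s
    Steps-+ i (suc j) s = Steps-+ i j s

    Steps-witness : {P : W → Set} → ∀ n {w} → Steps D n P w → ¬ ¬ Σ W P
    Steps-witness zero    p = pure (_ , p)
    Steps-witness (suc n) s = do
      (_ , step) ← Steps-witness n s
      (u , _ , _ , p) ← step
      pure (u , p)

    Reach-refl : {P : W → Set} {m : ℕ} → P ⊆ Reach D m P
    Reach-refl p = pure (0 , z≤n , p)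

    Reach-map : {P Q : W → Set} {m : ℕ} → (∀ {u} → P u → ¬ ¬ Q u) → Reach D m P ⊆ Reach D m Q
    Reach-map P⊆¬¬Q r = do
      (i , i≤m , s) ← r
      s′ ← Steps-¬¬ i (Steps-map P⊆¬¬Q i s)
      pure (i , i≤m , s′)

    Reach-cong : {P Q : W → Set} {m : ℕ} → (∀ {u} → P u ⇔ Q u) → ∀ {w} → Reach D m P w ⇔ Reach D m Q w
    Reach-cong P⇔Q = mk⇔ (Reach-map (pure ∘ to P⇔Q)) (Reach-map (pure ∘ from P⇔Q))

    Reach-∩ : {P : W → Set} {m : ℕ} {w : W} → D w → Reach D m P w → Reach D m (D ∩ P) w
    Reach-∩ d = ¬¬-map λ (i , i≤m , s) → i , i≤m , Steps-∩ i d s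

    Reach-⊎ : {P Q : W → Set} {m : ℕ} {w : W} →
              Reach D m (λ u → P u ⊎ Q u) w → ¬ ¬ (Reach D m P w ⊎ Reach D m Q w)
    Reach-⊎ r = do
      (i , i≤m , s) ← r
      s′ ← Steps-⊎ i s
      pure (Data.Sum.map (λ s → pure (i , i≤m , s)) (λ s → pure (i , i≤m , s)) s′)

    Reach-witness : {P : W → Set} {m : ℕ} {w : W} → Reach D m P w → ¬ ¬ Σ W P
    Reach-witness r = do
      (i , _ , s) ← r
      Steps-witness i s

  module _ {D : W → Set} {V : ℕ → W → Set} where

    Sat-subst : (σ : ℕ → Fm k) (φ : Fm k) {w : W} →
                Sat D V (subst σ φ) w ⇔ Sat D (λ n → Sat D V (σ n)) φ w
    Sat-subst σ (var n)   = ⇔-id _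
    Sat-subst σ bot       = ⇔-id _
    Sat-subst σ (φ ⇒ ψ)   = →-cong-⇔ (Sat-subst σ φ) (Sat-subst σ ψ)
    Sat-subst σ (dia a φ) = ¬¬-cong (mk⇔ (λ (u , r , d , s) → u , r , d , to (Sat-subst σ φ) s)
                                         (λ (u , r , d , s) → u , r , d , from (Sat-subst σ φ) s))

  StableValuation : (ℕ → W → Set) → Set
  StableValuation V = ∀ n w → Stable (V n w)

  module _ {D : W → Set} {V : ℕ → W → Set} (stV : StableValuation V) where

    Sat-stable : ∀ φ {w} → Stable (Sat D V φ w)
    Sat-stable (var n)   = stV n _
    Sat-stable bot       = λ ¬¬⊥ → ¬¬⊥ id
    Sat-stable (φ ⇒ ψ)   = λ ¬¬f x → Sat-stable ψ (¬¬-map (λ f → f x) ¬¬f)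
    Sat-stable (dia a φ) = negated-stable

    Sat-∧ : ∀ φ ψ {w} → Sat D V (φ ∧ᶠ ψ) w ⇔ (Sat D V φ w × Sat D V ψ w)
    Sat-∧ φ ψ = mk⇔
      (λ s → Sat-stable φ (λ ¬a → s λ a _ → ¬a a) , Sat-stable ψ (λ ¬b → s λ _ b → ¬b b))
      (λ (a , b) f → f a b)

    Sat-∨ : ∀ φ ψ {w} → Sat D V (φ ∨ᶠ ψ) w ⇔ (¬ ¬ (Sat D V φ w ⊎ Sat D V ψ w))
    Sat-∨ φ ψ = mk⇔ (λ f ¬a⊎b → ¬a⊎b (inj₂ (f (¬a⊎b ∘ inj₁))))
                    (λ a⊎b ¬a → Sat-stable ψ (¬¬-map [ ⊥-elim ∘ ¬a , id ]′ a⊎b))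

    Sat-bigOr : ∀ φs {w} → Sat D V (bigOr φs) w ⇔ (¬ ¬ Any (λ φ → Sat D V φ w) φs)
    Sat-bigOr []       = mk⇔ (λ ()) (λ ¬¬any → ¬¬any λ ())
    Sat-bigOr (φ ∷ φs) = mk⇔
      (λ s → to (Sat-∨ φ (bigOr φs)) s >>= [ pure ∘ here , ¬¬-map there ∘ to (Sat-bigOr φs) ]′)
      (λ ¬¬any → from (Sat-∨ φ (bigOr φs)) (¬¬-map (λ { (here s) → inj₁ s
                                                      ; (there any) → inj₂ (from (Sat-bigOr φs) (pure any)) })
                                                   ¬¬any))

    Sat-bigOr-map : {A : Set} (f : A → Fm k) (xs : List A) {w : W} →
                    Sat D V (bigOr (map f xs)) w ⇔ (¬ ¬ (Σ A λ x → x ∈ xs × Sat D V (f x) w))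
    Sat-bigOr-map f xs = ¬¬-cong (mk⇔ (find ∘ map⁻) (λ (_ , x∈ , s) → map⁺ (lose x∈ s)))
                         ⇔-∘ Sat-bigOr (map f xs)

    Sat-diaA : ∀ φ {w} → Sat D V (diaA φ) w ⇔ Step D (Sat D V φ) w
    Sat-diaA φ = mk⇔
      (λ s → do
        (a , _ , ¬¬succ) ← to (Sat-bigOr-map (λ a → dia a φ) (allFin k)) s
        (u , r , d , x) ← ¬¬succ
        pure (u , (a , r) , d , x))
      (λ step → from (Sat-bigOr-map (λ a → dia a φ) (allFin k)) do
        (u , (a , r) , d , x) ← step
        pure (a , ∈-allFin a , pure (u , r , d , x)))

    Sat-diaA^ : ∀ i φ {w} → Sat D V (diaA^ i φ) w ⇔ Steps D i (Sat D V φ) w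
    Sat-diaA^ zero    φ = ⇔-id _
    Sat-diaA^ (suc i) φ = Steps-cong (Sat-diaA φ) i ⇔-∘ Sat-diaA^ i (diaA φ)

    Sat-diaA≤ : ∀ m φ {w} → Sat D V (diaA≤ m φ) w ⇔ Reach D m (Sat D V φ) w
    Sat-diaA≤ m φ = ¬¬-cong (mk⇔ (λ (i , i∈ , s) → i , ≤-pred (∈-upTo⁻ i∈) , to (Sat-diaA^ i φ) s)
                                 (λ (i , i≤m , s) → i , ∈-upTo⁺ (s≤s i≤m) , from (Sat-diaA^ i φ) s))
                    ⇔-∘ Sat-bigOr-map (λ i → diaA^ i φ) (upTo (suc m))

  Sat-rel : {V : ℕ → W → Set} → StableValuation V → ∀ ξ φ {w} →
            Sat U V (rel ξ φ) w ⇔ Sat (Sat U V ξ) V φ w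
  Sat-rel stV ξ (var n)   = ⇔-id _
  Sat-rel stV ξ bot       = ⇔-id _
  Sat-rel stV ξ (φ ⇒ ψ)   = →-cong-⇔ (Sat-rel stV ξ φ) (Sat-rel stV ξ ψ)
  Sat-rel stV ξ (dia a φ) = ¬¬-cong (mk⇔
    (λ (u , r , _ , s) → let (d , x) = to (Sat-∧ stV ξ (rel ξ φ)) s in u , r , d , to (Sat-rel stV ξ φ) x)
    (λ (u , r , d , x) → u , r , _ , from (Sat-∧ stV ξ (rel ξ φ)) (d , from (Sat-rel stV ξ φ) x)))

module _ {k : ℕ} (F : Frame {k}) where
  open Frame F
  open Semantics W R

  Forces⇔Sat : (V : ℕ → W → Bool) (φ : Fm k) {w : W} →
               Forces F V w φ ⇔ Sat U (λ n w → V n w ≡ true) φ w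
  Forces⇔Sat V (var n)   = ⇔-id _
  Forces⇔Sat V bot       = ⇔-id _
  Forces⇔Sat V (φ ⇒ ψ)   = →-cong-⇔ (Forces⇔Sat V φ) (Forces⇔Sat V ψ)
  Forces⇔Sat V (dia a φ) = ¬¬-cong (mk⇔ (λ (u , r , s) → u , r , _ , to (Forces⇔Sat V φ) s)
                                        (λ (u , r , _ , s) → u , r , from (Forces⇔Sat V φ) s))

Odd : ℕ → Set
Odd zero    = ⊥
Odd (suc n) = ¬ Odd n

odd? : Decidable Odd
odd? zero    = no id
odd? (suc n) = ¬? (odd? n)

Odd⇔¬Odd-suc : ∀ n → Odd n ⇔ (¬ Odd (suc n))
Odd⇔¬Odd-suc n = mk⇔ (λ odd ¬odd → ¬odd odd) (decidable-stable (odd? n))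

module _ {k : ℕ} where

  alternation : ℕ → ℕ → Fm k
  alternation m zero    = top
  alternation m (suc n) = (p0 ∧ᶠ diaA≤ m (neg p0 ∧ᶠ alternation m n))
                       ∨ᶠ (neg p0 ∧ᶠ diaA≤ m (p0 ∧ᶠ alternation m n))

  alternation-inP₀P₁ : ∀ m n → InP₀P₁ (alternation m n)
  alternation-inP₀P₁ m zero    = neg-inP₀P₁ bot-inP₀P₁
  alternation-inP₀P₁ m (suc n) = ∨-inP₀P₁ (side p₀-inP₀P₁ (neg-inP₀P₁ p₀-inP₀P₁))
                                          (side (neg-inP₀P₁ p₀-inP₀P₁) p₀-inP₀P₁)
    where
      side : ∀ {χ χ′} → InP₀P₁ χ → InP₀P₁ χ′ → InP₀P₁ (χ ∧ᶠ diaA≤ m (χ′ ∧ᶠ alternation m n))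
      side χ∈ χ′∈ = ∧-inP₀P₁ χ∈ (diaA≤-inP₀P₁ m (∧-inP₀P₁ χ′∈ (alternation-inP₀P₁ m n)))

module InModel {k : ℕ} (F : Frame {k}) (V : ℕ → Frame.W F → Bool)
  {L : Fm k → Set} (valid : ∀ φ → L φ → ValidIn F φ) (closed : ∀ σ φ → L φ → L (subst σ φ))
  (m : ℕ) (depth : L (BoundedDepth m 0 1)) (r : ℕ) where

  open Frame F
  open Semantics W R

  Val : ℕ → W → Set
  Val n w = V n w ≡ true

  Val-stable : StableValuation Val
  Val-stable n w = decidable-stable (V n w ≟ᵇ true)

  ⟦_⟧ : Fm k → W → Set
  ⟦ φ ⟧ = Sat U Val φ

  true-in-model : ∀ {φ} → L φ → ∀ w → ⟦ φ ⟧ w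
  true-in-model {φ} ⊢φ w = to (Forces⇔Sat F V φ) (valid φ ⊢φ V w)

  D : W → Set
  D = Val r

  Definable : (W → Set) → Set
  Definable P = Σ (Fm k) λ ψ → ∀ {u} → P u ⇔ ⟦ ψ ⟧ u

  Step-definable : {P : W → Set} → Definable P → Definable (Step D P)
  Step-definable (ψ , P⇔ψ) = diaA (var r ∧ᶠ ψ) , mk⇔
    (λ step → from (Sat-diaA Val-stable (var r ∧ᶠ ψ)) (¬¬-map (λ (u , a , d , p) →
                u , a , _ , from (Sat-∧ Val-stable (var r) ψ) (d , to P⇔ψ p)) step))
    (λ s → ¬¬-map (λ (u , a , _ , x) → let (d , y) = to (Sat-∧ Val-stable (var r) ψ) x in
                u , a , d , from P⇔ψ y) (to (Sat-diaA Val-stable (var r ∧ᶠ ψ)) s))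

  -- The instance of BoundedDepth m 0 1 under p₀ ↦ ψ, p₁ ↦ r, read at u.
  Steps-suc⇒Reach : {P : W → Set} → Definable P → ∀ {u} → D u → Steps D (suc m) P u → Reach D m P u
  Steps-suc⇒Reach {P} (ψ , P⇔ψ) {u} d s =
    Reach-map (pure ∘ from P⇔ψ)
      (to (Sat-diaA≤ stable m p0) (bounded (from (Sat-diaA^ stable (suc m) p0) (Steps-map (to P⇔ψ) (suc m) s))))
    where
      σ : ℕ → Fm k
      σ zero    = ψ
      σ (suc _) = var r
      stable : StableValuation (λ n → ⟦ σ n ⟧)
      stable n _ = Sat-stable Val-stable (σ n)
      bounded : Sat D (λ n → ⟦ σ n ⟧) (diaA^ (suc m) p0 ⇒ diaA≤ m p0) u
      bounded = to (Sat-rel stable p1 (diaA^ (suc m) p0 ⇒ diaA≤ m p0))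
                   (to (Sat-subst σ (BoundedDepth m 0 1)) (true-in-model (closed σ _ depth) u) d)

  Steps⇒Reach : {P : W → Set} → Definable P → ∀ n {u} → D u → Steps D n P u → Reach D m P u
  Steps⇒Reach P-def zero    d p = Reach-refl p
  Steps⇒Reach {P} P-def (suc n) {u} d s = Steps⇒Reach (Step-definable P-def) n d s >>= λ (i , i≤m , s′) →
    extend (m≤n⇒m<n∨m≡n i≤m) s′
    where
      extend : ∀ {i} → i < m ⊎ i ≡ m → Steps D (suc i) P u → Reach D m P u
      extend {i} (inj₁ i<m) s = pure (suc i , i<m , s)
      extend     (inj₂ refl) s = Steps-suc⇒Reach P-def d s

  Reach-idempotent : {P : W → Set} → Definable P → ∀ {u} → D u → Reach D m (Reach D m P) u → Reach D m P u
  Reach-idempotent {P} P-def d r = do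
    (i , _ , s) ← r
    s′ ← Steps-¬¬ i s
    (j , s″) ← Steps-∃ {Q = λ j v → j ≤ m × Steps D j P v} i s′
    Steps⇒Reach P-def (j + i) d (Steps-+ i j (Steps-map proj₂ i s″))

  module Rank (h : ℕ) where

    Above : ℕ → W → Set
    Above i w = ¬ ¬ (Σ ℕ λ l → i ≤ l × l ≤ h × Val l w)

    above : ℕ → Fm k
    above i = bigOr (map var (filter (i ≤?_) (upTo (suc h))))

    Sat-above : {D′ : W → Set} (i : ℕ) {w : W} → Sat D′ Val (above i) w ⇔ Above i w
    Sat-above i = ¬¬-cong (mk⇔
      (λ (l , l∈ , v) → let (l∈upTo , i≤l) = ∈-filter⁻ (i ≤?_) l∈
                         in l , i≤l , ≤-pred (∈-upTo⁻ l∈upTo) , v)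
      (λ (l , i≤l , l≤h , v) → l , ∈-filter⁺ (i ≤?_) (∈-upTo⁺ (s≤s l≤h)) i≤l , v))
      ⇔-∘ Sat-bigOr-map Val-stable var (filter (i ≤?_) (upTo (suc h)))

    Above-split : ∀ i {w} → Above i w → ¬ ¬ (Val i w ⊎ Above (suc i) w)
    Above-split i above-i = do
      (l , i≤l , l≤h , v) ← above-i
      pure (split (m≤n⇒m<n∨m≡n i≤l) l≤h v)
      where
        split : ∀ {l w} → i < l ⊎ i ≡ l → l ≤ h → Val l w → Val i w ⊎ Above (suc i) w
        split {l} (inj₁ i<l) l≤h v = inj₂ (pure (l , i<l , l≤h , v))
        split     (inj₂ refl) _  v = inj₁ v

    Rank≥ : ℕ → W → Set
    Rank≥ zero    _ = ⊤
    Rank≥ (suc i) w = Reach D m (Above (suc i)) w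

    rank≥ : ℕ → Fm k
    rank≥ zero    = top
    rank≥ (suc i) = rel (var r) (diaA≤ m (above (suc i)))

    Rank≥-definable : ∀ i {w} → Rank≥ i w ⇔ ⟦ rank≥ i ⟧ w
    Rank≥-definable zero    = mk⇔ (λ _ → id) (λ _ → _)
    Rank≥-definable (suc i) = ⇔-sym (Sat-rel Val-stable (var r) (diaA≤ m (above (suc i))))
      ⇔-∘ (⇔-sym (Sat-diaA≤ Val-stable m (above (suc i))) ⇔-∘ Reach-cong (⇔-sym (Sat-above (suc i))))

    Rank≥-stable : ∀ i {w} → Stable (Rank≥ i w)
    Rank≥-stable zero    _ = _
    Rank≥-stable (suc i)   = negated-stable

    Rank≥-antitone : ∀ {i j} → i ≤ j → ∀ {w} → Rank≥ j w → Rank≥ i w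
    Rank≥-antitone {zero}          _   _ = _
    Rank≥-antitone {suc i} {suc j} i≤j   =
      Reach-map (pure ∘ ¬¬-map λ (l , j≤l , l≤h , v) → l , ≤-trans i≤j j≤l , l≤h , v)

    Rank≥-closed : ∀ i {w} → D w → Reach D m (Rank≥ i) w → Rank≥ i w
    Rank≥-closed zero    _ _ = _
    Rank≥-closed (suc i) d   = Reach-idempotent (above (suc i) , ⇔-sym (Sat-above (suc i))) d

    Rank≥-bounded : ∀ i {w} → Rank≥ i w → i ≤ h
    Rank≥-bounded zero    _    = z≤n
    Rank≥-bounded (suc i) rank = decidable-stable (suc i ≤? h) do
      (_ , above-i) ← Reach-witness rank
      (l , i<l , l≤h , _) ← above-i
      pure (≤-trans i<l l≤h)

    ¬Rank≥-top : ∀ {w} → ¬ Rank≥ (suc h) w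
    ¬Rank≥-top rank = <-irrefl refl (Rank≥-bounded (suc h) rank)

    HasRank : ℕ → W → Set
    HasRank n w = Rank≥ n w × ¬ Rank≥ (suc n) w

    HasRank-unique : ∀ {i j w} → HasRank i w → HasRank j w → i ≡ j
    HasRank-unique {i} {j} (ri , ¬ri+1) (rj , ¬rj+1) with <-cmp i j
    ... | tri< i<j _ _ = ⊥-elim (¬ri+1 (Rank≥-antitone i<j rj))
    ... | tri≈ _ i≡j _ = i≡j
    ... | tri> _ _ j<i = ⊥-elim (¬rj+1 (Rank≥-antitone j<i ri))

    hasRank : ℕ → Fm k
    hasRank n = rank≥ n ∧ᶠ neg (rank≥ (suc n))

    HasRank-definable : ∀ n {w} → HasRank n w ⇔ ⟦ hasRank n ⟧ w
    HasRank-definable n = ⇔-sym (Sat-∧ Val-stable (rank≥ n) (neg (rank≥ (suc n))))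
      ⇔-∘ (Rank≥-definable n ×-⇔ ¬-cong-⇔ (Rank≥-definable (suc n)))

    parity : Fm k
    parity = bigOr (map hasRank (filter odd? (upTo (suc h))))

    Parity : W → Set
    Parity = ⟦ parity ⟧

    Parity-of-rank : ∀ {n w} → HasRank n w → Parity w ⇔ Odd n
    Parity-of-rank {n} has-n = mk⇔
      (λ π → decidable-stable (odd? n) do
        (j , j∈ , has-j) ← to (Sat-bigOr-map Val-stable hasRank (filter odd? (upTo (suc h)))) π
        pure (substEq Odd (HasRank-unique (from (HasRank-definable j) has-j) has-n)
                          (proj₂ (∈-filter⁻ odd? {xs = upTo (suc h)} j∈))))
      (λ odd → from (Sat-bigOr-map Val-stable hasRank (filter odd? (upTo (suc h))))
        (pure (n , ∈-filter⁺ odd? (∈-upTo⁺ (s≤s (Rank≥-bounded n (proj₁ has-n)))) odd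
                 , to (HasRank-definable n) has-n)))

    Parity-same : ∀ {n y z} → HasRank n y → HasRank n z → Parity y → Parity z
    Parity-same has-y has-z = from (Parity-of-rank has-z) ∘ to (Parity-of-rank has-y)

    Parity-flip : ∀ {n y z} → HasRank (suc n) y → HasRank n z → Parity z ⇔ (¬ Parity y)
    Parity-flip {n} has-y has-z =
      ⇔-sym (¬-cong-⇔ (Parity-of-rank has-y)) ⇔-∘ (Odd⇔¬Odd-suc n ⇔-∘ Parity-of-rank has-z)

    Alt : ℕ → W → Set
    Alt zero    _ = ⊤
    Alt (suc n) w = ¬ ¬ ((Parity w × Reach D m (∁ Parity ∩ Alt n) w)
                       ⊎ (¬ Parity w × Reach D m (Parity ∩ Alt n) w))

    σπ : ℕ → Fm k
    σπ zero    = parity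
    σπ (suc _) = var r

    Vπ : ℕ → W → Set
    Vπ n = ⟦ σπ n ⟧

    Vπ-stable : StableValuation Vπ
    Vπ-stable n _ = Sat-stable Val-stable (σπ n)

    Sat-alternation : ∀ n {w} → Sat D Vπ (alternation m n) w ⇔ Alt n w
    Sat-alternation zero    = mk⇔ _ (λ _ → id)
    Sat-alternation (suc n) =
      ¬¬-cong (side p0 (neg p0) ⊎-⇔ side (neg p0) p0)
      ⇔-∘ Sat-∨ Vπ-stable (branch p0 (neg p0)) (branch (neg p0) p0)
      where
        branch : Fm k → Fm k → Fm k
        branch χ χ′ = χ ∧ᶠ diaA≤ m (χ′ ∧ᶠ alternation m n)
        side : ∀ χ χ′ {w} → Sat D Vπ (branch χ χ′) w
                          ⇔ (Sat D Vπ χ w × Reach D m (Sat D Vπ χ′ ∩ Alt n) w)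
        side χ χ′ =
          (⇔-id _ ×-⇔ (Reach-cong ((⇔-id _ ×-⇔ Sat-alternation n) ⇔-∘ Sat-∧ Vπ-stable χ′ (alternation m n))
                       ⇔-∘ Sat-diaA≤ Vπ-stable m (χ′ ∧ᶠ alternation m n)))
          ⇔-∘ Sat-∧ Vπ-stable χ (diaA≤ m (χ′ ∧ᶠ alternation m n))

    Alt-in-model : ∀ {n c w} → L (rel p1 (alternation m n) ⇔ᶠ c) → Alt n w ⇔ Sat U Vπ c w
    Alt-in-model {n} {c} {w} ⊢alt⇔c =
      let (alt⇒c , c⇒alt) = to (Sat-∧ Vπ-stable (alt ⇒ c) (c ⇒ alt))
                                (to (Sat-subst σπ (alt ⇔ᶠ c)) (true-in-model (closed σπ _ ⊢alt⇔c) w))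
      in mk⇔ (alt⇒c ∘ from alt-sem) (to alt-sem ∘ c⇒alt)
      where
        alt : Fm k
        alt = rel p1 (alternation m n)
        alt-sem : Sat U Vπ alt w ⇔ Alt n w
        alt-sem = Sat-alternation n ⇔-∘ Sat-rel Vπ-stable p1 (alternation m n)

    Alt-transfer : ∀ {i j c w} → L (rel p1 (alternation m i) ⇔ᶠ c) → L (rel p1 (alternation m j) ⇔ᶠ c) →
                   Alt i w → Alt j w
    Alt-transfer ⊢i ⊢j = from (Alt-in-model ⊢j) ∘ to (Alt-in-model ⊢i)

    -- If z had rank exactly n, the reachable Alt n-worlds of the other parity
    -- would have rank ≥ n by induction, hence ≥ n + 1 by parity, and so would z.
    Alt⇒Rank≥ : ∀ n {z} → D z → Alt n z → Rank≥ n z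
    Alt⇒Rank≥ zero    _ _ = _
    Alt⇒Rank≥ (suc n) {z} d alt = Rank≥-stable (suc n) λ ¬rank → alt λ
      { (inj₁ (πz , r))  → ¬rank (climb ¬rank (Reach-map (λ (¬πy , a) → pure (a , λ y≈z → ¬πy (from y≈z πz))) r))
      ; (inj₂ (¬πz , r)) → ¬rank (climb ¬rank (Reach-map (λ (πy , a) → pure (a , λ y≈z → ¬πz (to y≈z πy))) r))
      }
      where
        climb : ¬ Rank≥ (suc n) z → Reach D m (λ y → Alt n y × ¬ (Parity y ⇔ Parity z)) z → Rank≥ (suc n) z
        climb ¬rank r = Rank≥-closed (suc n) d (Reach-map
          (λ (dy , a , differ) ¬rank-y →
            differ (mk⇔ (Parity-same (Alt⇒Rank≥ n dy a , ¬rank-y) has-n)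
                        (Parity-same has-n (Alt⇒Rank≥ n dy a , ¬rank-y))))
          (Reach-∩ d r))
          where
            has-n : HasRank n z
            has-n = Rank≥-closed n d (Reach-map (λ (dy , a , _) → pure (Alt⇒Rank≥ n dy a)) (Reach-∩ d r))
                  , ¬rank

    B-boxed : ℕ → Fm k
    B-boxed j = diaA≤ m (var (suc j)) ∨ᶠ B m j

    ¬B-unfold : ∀ j {u} → ¬ Sat D Val (B m (suc j)) u → Val (suc j) u × Reach D m (∁ (Sat D Val (B-boxed j))) u
    ¬B-unfold j ¬B = Val-stable (suc j) _ (λ ¬v → ¬B (⊥-elim ∘ ¬v))
                   , to (Sat-diaA≤ Val-stable m (neg (B-boxed j)))
                        (Sat-stable Val-stable (diaA≤ m (neg (B-boxed j))) (λ ¬r → ¬B (λ _ → ¬r)))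

    ¬B-boxed-split : ∀ j {z} → ¬ Sat D Val (B-boxed j) z →
                     ¬ Reach D m (Val (suc j)) z × ¬ Sat D Val (B m j) z
    ¬B-boxed-split j ¬boxed =
        (λ r → ¬boxed (from B-boxed-sem (pure (inj₁ (from (Sat-diaA≤ Val-stable m (var (suc j))) r)))))
      , (λ b → ¬boxed (from B-boxed-sem (pure (inj₂ b))))
      where B-boxed-sem = Sat-∨ Val-stable (diaA≤ m (var (suc j))) (B m j)

    ¬Rank≥-suc : ∀ j {z} → ¬ Reach D m (Val (suc j)) z → ¬ Rank≥ (suc (suc j)) z → ¬ Rank≥ (suc j) z
    ¬Rank≥-suc j ¬reach ¬rank rank = Reach-⊎ (Reach-map (Above-split (suc j)) rank) [ ¬reach , ¬rank ]′

    Reach-below : ∀ i {P u} → D u → ¬ Rank≥ i u → Reach D m P u → Reach D m (P ∩ ∁ (Rank≥ i)) u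
    Reach-below i d ¬rank r = do
      split ← Reach-⊎ (Reach-map (λ p → ¬¬-map (λ { (yes rank) → inj₁ rank ; (no ¬rank′) → inj₂ (p , ¬rank′) })
                                             ¬¬-excluded-middle) r)
      [ (λ r-rank → ⊥-elim (¬rank (Rank≥-closed i d r-rank))) , id ]′ split

    Alt-suc : ∀ j {u} → HasRank (suc j) u → Reach D m (λ z → HasRank j z × Alt j z) u → Alt (suc j) u
    Alt-suc j {u} has-u r = ¬¬-map choose ¬¬-excluded-middle
      where
        choose : Dec (Parity u) → _
        choose (yes πu) =
          inj₁ (πu , Reach-map (λ (has-z , a) → pure ((λ πz → to (Parity-flip has-u has-z) πz πu) , a)) r)
        choose (no ¬πu) =
          inj₂ (¬πu , Reach-map (λ (has-z , a) → pure (from (Parity-flip has-u has-z) ¬πu , a)) r)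

    Witnesses : ℕ → Set
    Witnesses j = ∀ i → i ≤ j → ¬ ¬ Σ W λ y → D y × Alt i y × ¬ Rank≥ (suc i) y

    refute-B : ∀ j → j ≤ h → ∀ {u} → D u → ¬ Sat D Val (B m j) u → ¬ Rank≥ (suc j) u →
               Rank≥ j u × Alt j u × Witnesses j
    refute-B zero    _    d _  ¬rank = _ , _ , λ { zero z≤n → pure (_ , d , _ , ¬rank) }
    refute-B (suc j) sj≤h {u} d ¬B ¬rank = rank-u , alt-u , witnesses
      where
        rank-u : Rank≥ (suc j) u
        rank-u = Reach-refl (pure (suc j , ≤-refl , sj≤h , proj₁ (¬B-unfold j ¬B)))
        below : ∀ {z} → ((D ∩ ∁ (Sat D Val (B-boxed j))) ∩ ∁ (Rank≥ (suc (suc j)))) z →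
                HasRank j z × Alt j z × Witnesses j
        below ((dz , ¬boxed) , ¬rank-z) =
          let (¬reach , ¬B) = ¬B-boxed-split j ¬boxed
              ¬rank′ = ¬Rank≥-suc j ¬reach ¬rank-z
              (rank-z , alt-z , wit) = refute-B j (≤-trans (n≤1+n j) sj≤h) dz ¬B ¬rank′
          in (rank-z , ¬rank′) , alt-z , wit
        reach-below : Reach D m (λ z → HasRank j z × Alt j z × Witnesses j) u
        reach-below =
          Reach-map (pure ∘ below) (Reach-below (suc (suc j)) d ¬rank (Reach-∩ d (proj₂ (¬B-unfold j ¬B))))
        alt-u : Alt (suc j) u
        alt-u = Alt-suc j (rank-u , ¬rank) (Reach-map (λ (has , a , _) → pure (has , a)) reach-below)
        witnesses : Witnesses (suc j)
        witnesses i i≤sj with m≤n⇒m<n∨m≡n i≤sj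
        ... | inj₁ (s≤s i≤j) = Reach-witness reach-below >>= λ (_ , _ , _ , wit) → wit i i≤j
        ... | inj₂ refl      = pure (u , d , alt-u , ¬rank)

    -- A refutation of B_h^{[m]} yields a world of rank exactly i with an
    -- alternation of length i, hence (by the L-equivalence) one of length j > i.
    B-valid : ∀ {i j c} → i < j → j ≤ h →
              L (rel p1 (alternation m i) ⇔ᶠ c) → L (rel p1 (alternation m j) ⇔ᶠ c) →
              ∀ w → Forces F V w (var r ⇒ rel (var r) (B m h))
    B-valid {i} {j} i<j j≤h ⊢i ⊢j w d =
      from (Forces⇔Sat F V (rel (var r) (B m h))) (from (Sat-rel Val-stable (var r) (B m h))
        (Sat-stable Val-stable (B m h) λ ¬B →
          proj₂ (proj₂ (refute-B h ≤-refl d ¬B ¬Rank≥-top)) i (≤-trans (<⇒≤ i<j) j≤h)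
            λ (y , dy , alt , ¬rank) → ¬rank (Rank≥-antitone i<j (Alt⇒Rank≥ j dy (Alt-transfer ⊢i ⊢j alt)))))

bounded-alternation : {k : ℕ} {L : Fm k → Set} → IsNormal L → TwoFinite L →
                      ∀ {m} → L (BoundedDepth m 0 1) → KripkeComplete L →
                      Σ ℕ λ h → ∀ r → L (var r ⇒ rel (var r) (B m h))
bounded-alternation {L = L} N two {m} depth (C , complete)
  with i , j , i<j , j≤h , _ , ⊢i , ⊢j ← two-finite-collision {L = L} two (λ n → rel p1 (alternation m n))
                                           (λ n → rel-inP₀P₁ p₁-inP₀P₁ (alternation-inP₀P₁ m n))
  = length (proj₁ two) , λ r → proj₂ (complete _) λ F F∈C V →
      InModel.Rank.B-valid F V (λ φ ⊢φ → proj₁ (complete φ) ⊢φ F F∈C) (IsNormal.sub N) m depth r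
        (length (proj₁ two)) i<j j≤h ⊢i ⊢j

rename₀₁ : ℕ → ℕ → ℕ → ℕ
rename₀₁ p q zero          = p
rename₀₁ p q (suc zero)    = q
rename₀₁ p q (suc (suc n)) = suc (suc n)

theorem3p9 : (k : ℕ) (L : Fm k → Set) → IsNormal L → TwoFinite L →
    (p q : ℕ) → p ≢ q →
    Σ ℕ λ m →
      L (var q ⇒ rel (var q) (diaA^ (suc m) (var p) ⇒ diaA≤ m (var p)))
      × (KripkeComplete L →
          Σ ℕ λ h → ∀ r → ¬ Occurs r (B {k} m h) → L (var r ⇒ rel (var r) (B m h)))
theorem3p9 k L N two p q _ with m , depth ← bounded-depth N two =
  m , substEq L (rename-BoundedDepth (rename₀₁ p q) m 0 1) (IsNormal.sub N (var ∘ rename₀₁ p q) _ depth)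
    , λ complete → let (h , B-valid) = bounded-alternation N two depth complete in h , λ r _ → B-valid r
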